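{- Let $G$ be a finite simple connected graph with vertex set $\{1,\dots,n\}$ and Gram matrix $K=(L+J)^{ -1}$. For every vertex $i$, $K_{i,i}\ge\frac{1}{d_i+1}$, where $d_i$ is the degree of $i$. In particular $K_{i,i}\ge\frac1n$. Equality $K_{i,i}=\frac1n$ holds if and only if $i$ is a dominating vertex of $G$, i.e. $i$ is adjacent to all other vertices.
   Context: $L=D-A$ is the Laplacian ($A$ adjacency matrix, $D$ degree matrix), and $J$ is the all-ones matrix. -}

module Defs where

open import Data.Nat using (ℕ; zero; suc)
open import Data.Bool using (Bool; true; false; if_then_else_)
open import Data.Fin using (Fin; zero; suc)
open import Data.Fin.Properties using (_≟_)
open import Relation.Nullary using (does)
open import Relation.Binary.PropositionalEquality using (_≡_; _≢_)
open import Data.Rational using (ℚ; 0ℚ; 1ℚ; _+_; _*_; -_)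
import Data.Rational as ℚ
open import Data.Integer using (+_)

-- A finite simple graph on vertex set Fin n (vertices 0..n-1 ≅ 1..n):
-- decidable symmetric irreflexive adjacency relation.
record Graph (n : ℕ) : Set where
  field
    adj    : Fin n → Fin n → Bool
    sym    : ∀ i j → adj i j ≡ adj j i
    irrefl : ∀ i → adj i i ≡ false
open Graph public

sumℕ : ∀ {n} → (Fin n → ℕ) → ℕ
sumℕ {zero}  f = 0
sumℕ {suc n} f = f zero Data.Nat.+ sumℕ (λ j → f (suc j))

sumℚ : ∀ {n} → (Fin n → ℚ) → ℚ
sumℚ {zero}  f = 0ℚ
sumℚ {suc n} f = f zero + sumℚ (λ j → f (suc j))

degree : ∀ {n} → Graph n → Fin n → ℕ
degree G i = sumℕ (λ j → if adj G i j then 1 else 0)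

data Walk {n} (G : Graph n) : Fin n → Fin n → Set where
  here : ∀ {i} → Walk G i i
  step : ∀ {i j k} → adj G i j ≡ true → Walk G j k → Walk G i k

Connected : ∀ {n} → Graph n → Set
Connected G = ∀ i j → Walk G i j

Matrix : ℕ → Set
Matrix n = Fin n → Fin n → ℚ

adjMat : ∀ {n} → Graph n → Matrix n
adjMat G i j = if adj G i j then 1ℚ else 0ℚ

degMat : ∀ {n} → Graph n → Matrix n
degMat G i j = if does (i ≟ j) then ((+ (degree G i)) ℚ./ 1) else 0ℚ

laplacian : ∀ {n} → Graph n → Matrix n
laplacian G i j = degMat G i j + (- adjMat G i j)

Jmat : ∀ {n} → Matrix n
Jmat i j = 1ℚ

idMat : ∀ {n} → Matrix n
idMat i j = if does (i ≟ j) then 1ℚ else 0ℚ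

_⊕_ : ∀ {n} → Matrix n → Matrix n → Matrix n
(M ⊕ N) i j = M i j + N i j

_⊗_ : ∀ {n} → Matrix n → Matrix n → Matrix n
(M ⊗ N) i k = sumℚ (λ j → M i j * N j k)

IsInverseOf : ∀ {n} → Matrix n → Matrix n → Set
IsInverseOf K M = (∀ i j → (M ⊗ K) i j ≡ idMat i j) Data.Product.× (∀ i j → (K ⊗ M) i j ≡ idMat i j)
  where import Data.Product

Dominating : ∀ {n} → Graph n → Fin n → Set
Dominating G i = ∀ j → j ≢ i → adj G i j ≡ true

-- M = L + J is symmetric positive semidefinite: xᵀMx = ½ Σₐ Σ_b A_ab (xₐ - x_b)² + (Σₐ xₐ)².
-- With u = K eᵢ (so M u = eᵢ) and c = Mᵢᵢ = dᵢ + 1, the vector y = c u - eᵢ has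
-- yᵀMy = c (c Kᵢᵢ - 1) ≥ 0, whence Kᵢᵢ ≥ 1/(dᵢ + 1) ≥ 1/n. If i is dominating, the i-th
-- column of M is c eᵢ, so K M = I gives Kᵢᵢ = 1/c = 1/n; otherwise dᵢ + 1 < n and the
-- bound 1/(dᵢ + 1) is already strictly above 1/n.
module Submission where

import Algebra.Properties.CommutativeMonoid.Sum as CommutativeMonoidSum
open import Data.Bool using (Bool; true; false; if_then_else_)
open import Data.Empty using (⊥-elim)
open import Data.Fin using (Fin; zero; suc; punchIn)
open import Data.Fin.Properties using (_≟_; suc-injective; punchInᵢ≢i; punchIn-punchOut)
open import Data.Integer as ℤ using (+_)
import Data.Integer.Properties as ℤ
open import Data.Nat as ℕ using (ℕ; zero; suc)
import Data.Nat.Properties as ℕ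
open import Data.Product using (_×_; _,_; proj₁; proj₂)
open import Data.Rational
  using (ℚ; 0ℚ; 1ℚ; ½; _+_; _*_; -_; _-_; _/_; _≤_; _<_; *≤*; toℚᵘ; positive; nonNegative; nonPositive)
open import Data.Rational.Properties hiding (_≟_)
import Data.Rational.Properties as ℚ using (_≟_)
import Data.Rational.Unnormalised as ℚᵘ
import Data.Rational.Unnormalised.Properties as ℚᵘ
open import Data.Sum using (inj₁; inj₂)
open import Data.Vec.Functional using (Vector; removeAt)
open import Defs renaming (sym to adj-sym)
open import Function.Base using (_∘_)
open import Function.Bundles using (_⇔_; mk⇔)
open import Level using (0ℓ)
open import Relation.Binary.PropositionalEquality
open import Relation.Nullary using (Dec; yes; no)
open import Relation.Nullary.Decidable using (dec-true; dec-false; dec⇒maybe)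
import Tactic.RingSolver.Core.AlmostCommutativeRing as ACR
open import Tactic.RingSolver using (solve-∀)

fromℕ : ℕ → ℚ
fromℕ n = + n / 1

-- n / suc k unfolds to fromℚᵘ (mkℚᵘ n k).
toℚᵘ-/suc : ∀ n k → toℚᵘ (n / suc k) ℚᵘ.≃ ℚᵘ.mkℚᵘ n k
toℚᵘ-/suc n k = toℚᵘ-fromℚᵘ (ℚᵘ.mkℚᵘ n k)

fromℕ-+ : ∀ m n → fromℕ (m ℕ.+ n) ≡ fromℕ m + fromℕ n
fromℕ-+ m n = toℚᵘ-injective (begin
  toℚᵘ (fromℕ (m ℕ.+ n))                     ≈⟨ toℚᵘ-/suc (+ (m ℕ.+ n)) 0 ⟩
  ℚᵘ.mkℚᵘ (+ (m ℕ.+ n)) 0                    ≈⟨ ℚᵘ.*≡* (cong (ℤ._* + 1) numerators) ⟩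
  ℚᵘ.mkℚᵘ (+ m) 0 ℚᵘ.+ ℚᵘ.mkℚᵘ (+ n) 0       ≈⟨ ℚᵘ.+-cong (toℚᵘ-/suc (+ m) 0) (toℚᵘ-/suc (+ n) 0) ⟨
  toℚᵘ (fromℕ m) ℚᵘ.+ toℚᵘ (fromℕ n)         ≈⟨ toℚᵘ-homo-+ (fromℕ m) (fromℕ n) ⟨
  toℚᵘ (fromℕ m + fromℕ n)                   ∎)
  where
  open ℚᵘ.≃-Reasoning
  numerators : + (m ℕ.+ n) ≡ + m ℤ.* + 1 ℤ.+ + n ℤ.* + 1
  numerators = trans (ℤ.pos-+ m n) (sym (cong₂ ℤ._+_ (ℤ.*-identityʳ (+ m)) (ℤ.*-identityʳ (+ n))))

1/suc-inverseˡ : ∀ n → + 1 / suc n * fromℕ (suc n) ≡ 1ℚ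
1/suc-inverseˡ n = toℚᵘ-injective (begin
  toℚᵘ (+ 1 / suc n * fromℕ (suc n))                     ≈⟨ toℚᵘ-homo-* (+ 1 / suc n) (fromℕ (suc n)) ⟩
  toℚᵘ (+ 1 / suc n) ℚᵘ.* toℚᵘ (fromℕ (suc n))           ≈⟨ ℚᵘ.*-cong (toℚᵘ-/suc (+ 1) n) (toℚᵘ-/suc (+ suc n) 0) ⟩
  ℚᵘ.mkℚᵘ (+ 1) n ℚᵘ.* ℚᵘ.mkℚᵘ (+ suc n) 0                ≈⟨ ℚᵘ.*≡* cross ⟩
  ℚᵘ.1ℚᵘ                                                 ∎)
  where
  open ℚᵘ.≃-Reasoning
  cross : (+ 1 ℤ.* + suc n) ℤ.* + 1 ≡ + 1 ℤ.* + (suc n ℕ.* 1)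
  cross = trans (ℤ.*-identityʳ _) (cong (λ k → + 1 ℤ.* + k) (sym (ℕ.*-identityʳ (suc n))))

1/suc-antimono-≤ : ∀ {m n} → m ℕ.≤ n → + 1 / suc n ≤ + 1 / suc m
1/suc-antimono-≤ {m} {n} m≤n = toℚᵘ-cancel-≤
  (ℚᵘ.≤-respʳ-≃ (ℚᵘ.≃-sym (toℚᵘ-/suc (+ 1) m)) (ℚᵘ.≤-respˡ-≃ (ℚᵘ.≃-sym (toℚᵘ-/suc (+ 1) n))
    (ℚᵘ.*≤* (subst₂ ℤ._≤_ (sym (ℤ.*-identityˡ _)) (sym (ℤ.*-identityˡ _)) (ℤ.+≤+ (ℕ.s≤s m≤n))))))

1/suc-antimono-< : ∀ {m n} → m ℕ.< n → + 1 / suc n < + 1 / suc m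
1/suc-antimono-< {m} {n} m<n = toℚᵘ-cancel-<
  (ℚᵘ.<-respʳ-≃ (ℚᵘ.≃-sym (toℚᵘ-/suc (+ 1) m)) (ℚᵘ.<-respˡ-≃ (ℚᵘ.≃-sym (toℚᵘ-/suc (+ 1) n))
    (ℚᵘ.*<* (subst₂ ℤ._<_ (sym (ℤ.*-identityˡ _)) (sym (ℤ.*-identityˡ _)) (ℤ.+<+ (ℕ.s≤s m<n))))))

1≤[1+n]p⇒1/[1+n]≤p : ∀ n {p} → 1ℚ ≤ fromℕ (suc n) * p → + 1 / suc n ≤ p
1≤[1+n]p⇒1/[1+n]≤p n {p} 1≤[1+n]p = begin
  + 1 / suc n                           ≡⟨ *-identityʳ (+ 1 / suc n) ⟨
  + 1 / suc n * 1ℚ                      ≤⟨ *-monoˡ-≤-nonNeg (+ 1 / suc n) {{normalize-nonNeg 1 (suc n)}} 1≤[1+n]p ⟩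
  + 1 / suc n * (fromℕ (suc n) * p)     ≡⟨ *-assoc (+ 1 / suc n) (fromℕ (suc n)) p ⟨
  + 1 / suc n * fromℕ (suc n) * p       ≡⟨ cong (_* p) (1/suc-inverseˡ n) ⟩
  1ℚ * p                                ≡⟨ *-identityˡ p ⟩
  p                                     ∎
  where open ≤-Reasoning

p[1+n]≡1⇒p≡1/[1+n] : ∀ n {p} → p * fromℕ (suc n) ≡ 1ℚ → p ≡ + 1 / suc n
p[1+n]≡1⇒p≡1/[1+n] n {p} p[1+n]≡1 = begin
  p                                     ≡⟨ *-identityˡ p ⟨
  1ℚ * p                                ≡⟨ cong (_* p) (1/suc-inverseˡ n) ⟨
  + 1 / suc n * fromℕ (suc n) * p       ≡⟨ *-assoc (+ 1 / suc n) (fromℕ (suc n)) p ⟩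
  + 1 / suc n * (fromℕ (suc n) * p)     ≡⟨ cong (+ 1 / suc n *_) (trans (*-comm (fromℕ (suc n)) p) p[1+n]≡1) ⟩
  + 1 / suc n * 1ℚ                      ≡⟨ *-identityʳ (+ 1 / suc n) ⟩
  + 1 / suc n                           ∎
  where open ≡-Reasoning

ℚ-ring : ACR.AlmostCommutativeRing 0ℓ 0ℓ
ℚ-ring = ACR.fromCommutativeRing +-*-commutativeRing (λ x → dec⇒maybe (0ℚ ℚ.≟ x))

module Σ = CommutativeMonoidSum +-0-commutativeMonoid

sumℚ≡sum : ∀ {n} (f : Vector ℚ n) → sumℚ f ≡ Σ.sum f
sumℚ≡sum {zero}  f = refl
sumℚ≡sum {suc n} f = cong (_+_ (f zero)) (sumℚ≡sum (f ∘ suc))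

sumℚ-cong : ∀ {n} {f g : Vector ℚ n} → (∀ a → f a ≡ g a) → sumℚ f ≡ sumℚ g
sumℚ-cong {zero}  f≗g = refl
sumℚ-cong {suc n} f≗g = cong₂ _+_ (f≗g zero) (sumℚ-cong (f≗g ∘ suc))

sumℚ-distrib-+ : ∀ {n} (f g : Vector ℚ n) → sumℚ (λ a → f a + g a) ≡ sumℚ f + sumℚ g
sumℚ-distrib-+ {zero}  f g = refl
sumℚ-distrib-+ {suc n} f g = trans (cong (_+_ (f zero + g zero)) (sumℚ-distrib-+ (f ∘ suc) (g ∘ suc)))
  (interchange (f zero) (g zero) (sumℚ (f ∘ suc)) (sumℚ (g ∘ suc)))
  where
  interchange : ∀ a b c d → a + b + (c + d) ≡ (a + c) + (b + d)
  interchange = solve-∀ ℚ-ring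

sumℚ-distrib-‿- : ∀ {n} (f g : Vector ℚ n) → sumℚ (λ a → f a - g a) ≡ sumℚ f - sumℚ g
sumℚ-distrib-‿- {zero}  f g = refl
sumℚ-distrib-‿- {suc n} f g = trans (cong (_+_ (f zero - g zero)) (sumℚ-distrib-‿- (f ∘ suc) (g ∘ suc)))
  (interchange (f zero) (g zero) (sumℚ (f ∘ suc)) (sumℚ (g ∘ suc)))
  where
  interchange : ∀ a b c d → a - b + (c - d) ≡ (a + c) - (b + d)
  interchange = solve-∀ ℚ-ring

sumℚ-*ˡ : ∀ {n} c (f : Vector ℚ n) → sumℚ (λ a → c * f a) ≡ c * sumℚ f
sumℚ-*ˡ {zero}  c f = sym (*-zeroʳ c)
sumℚ-*ˡ {suc n} c f = trans (cong (_+_ (c * f zero)) (sumℚ-*ˡ c (f ∘ suc)))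
  (sym (*-distribˡ-+ c (f zero) (sumℚ (f ∘ suc))))

sumℚ-comm : ∀ {m n} (f : Fin m → Fin n → ℚ) →
            sumℚ (λ a → sumℚ (f a)) ≡ sumℚ (λ b → sumℚ (λ a → f a b))
sumℚ-comm f = begin
  sumℚ (λ a → sumℚ (f a))                ≡⟨ sumℚ-cong (λ a → sumℚ≡sum (f a)) ⟩
  sumℚ (λ a → Σ.sum (f a))               ≡⟨ sumℚ≡sum (λ a → Σ.sum (f a)) ⟩
  Σ.sum (λ a → Σ.sum (f a))              ≡⟨ Σ.∑-comm f ⟩
  Σ.sum (λ b → Σ.sum (λ a → f a b))      ≡⟨ sumℚ≡sum (λ b → Σ.sum (λ a → f a b)) ⟨
  sumℚ (λ b → Σ.sum (λ a → f a b))       ≡⟨ sumℚ-cong (λ b → sumℚ≡sum (λ a → f a b)) ⟨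
  sumℚ (λ b → sumℚ (λ a → f a b))        ∎
  where open ≡-Reasoning

sumℚ-only : ∀ {n} (i : Fin n) (f : Vector ℚ n) → (∀ a → a ≢ i → f a ≡ 0ℚ) → sumℚ f ≡ f i
sumℚ-only {suc n} zero    f f≡0 = trans (cong (_+_ (f zero)) (sumℚ-zero (f ∘ suc) (λ a → f≡0 (suc a) λ ())))
                                        (+-identityʳ (f zero))
  where
  sumℚ-zero : ∀ {n} (g : Vector ℚ n) → (∀ a → g a ≡ 0ℚ) → sumℚ g ≡ 0ℚ
  sumℚ-zero {zero}  g g≡0 = refl
  sumℚ-zero {suc n} g g≡0 = cong₂ _+_ (g≡0 zero) (sumℚ-zero (g ∘ suc) (g≡0 ∘ suc))
sumℚ-only {suc n} (suc i) f f≡0 = trans (cong (_+ sumℚ (f ∘ suc)) (f≡0 zero λ ()))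
  (trans (+-identityˡ _) (sumℚ-only i (f ∘ suc) (λ a a≢i → f≡0 (suc a) (a≢i ∘ suc-injective))))

sumℚ-nonNeg : ∀ {n} (f : Vector ℚ n) → (∀ a → 0ℚ ≤ f a) → 0ℚ ≤ sumℚ f
sumℚ-nonNeg {zero}  f 0≤f = ≤-refl
sumℚ-nonNeg {suc n} f 0≤f = +-mono-≤ (0≤f zero) (sumℚ-nonNeg (f ∘ suc) (0≤f ∘ suc))

idMat-diag : ∀ {n} (i : Fin n) → idMat i i ≡ 1ℚ
idMat-diag i = cong (if_then 1ℚ else 0ℚ) (dec-true (i ≟ i) refl)

idMat-≢ : ∀ {n} {a b : Fin n} → a ≢ b → idMat a b ≡ 0ℚ
idMat-≢ {a = a} {b} a≢b = cong (if_then 1ℚ else 0ℚ) (dec-false (a ≟ b) a≢b)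

sumℚ-idMat : ∀ {n} (i : Fin n) (f : Vector ℚ n) → sumℚ (λ a → idMat a i * f a) ≡ f i
sumℚ-idMat i f = begin
  sumℚ (λ a → idMat a i * f a)   ≡⟨ sumℚ-only i _ (λ a a≢i → trans (cong (_* f a) (idMat-≢ a≢i)) (*-zeroˡ (f a))) ⟩
  idMat i i * f i                ≡⟨ cong (_* f i) (idMat-diag i) ⟩
  1ℚ * f i                       ≡⟨ *-identityˡ (f i) ⟩
  f i                            ∎
  where open ≡-Reasoning

_*ᵥ_ : ∀ {n} → Matrix n → Vector ℚ n → Vector ℚ n
(M *ᵥ x) a = sumℚ (λ b → M a b * x b)

quadForm : ∀ {n} → Matrix n → Vector ℚ n → ℚ
quadForm M x = sumℚ (λ a → x a * (M *ᵥ x) a)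

SymmetricMatrix : ∀ {n} → Matrix n → Set
SymmetricMatrix M = ∀ a b → M a b ≡ M b a

PositiveSemidefinite : ∀ {n} → Matrix n → Set
PositiveSemidefinite M = ∀ x → 0ℚ ≤ quadForm M x

module InverseColumn {n} {M : Matrix n} {u : Vector ℚ n} (i : Fin n)
                     (M-sym : SymmetricMatrix M) (Mu≡eᵢ : ∀ a → (M *ᵥ u) a ≡ idMat a i) where

  c : ℚ
  c = M i i

  y : Vector ℚ n
  y a = c * u a - idMat a i

  *ᵥ-y : ∀ a → (M *ᵥ y) a ≡ c * idMat a i - M a i
  *ᵥ-y a = begin
    sumℚ (λ b → M a b * (c * u b - idMat b i))                     ≡⟨ sumℚ-cong (λ b → distribute (M a b) c (u b) (idMat b i)) ⟩
    sumℚ (λ b → c * (M a b * u b) - idMat b i * M a b)             ≡⟨ sumℚ-distrib-‿- (λ b → c * (M a b * u b)) (λ b → idMat b i * M a b) ⟩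
    sumℚ (λ b → c * (M a b * u b)) - sumℚ (λ b → idMat b i * M a b) ≡⟨ cong₂ _-_ (sumℚ-*ˡ c (λ b → M a b * u b)) (sumℚ-idMat i (M a)) ⟩
    c * (M *ᵥ u) a - M a i                                         ≡⟨ cong (λ v → c * v - M a i) (Mu≡eᵢ a) ⟩
    c * idMat a i - M a i                                          ∎
    where
    open ≡-Reasoning
    distribute : ∀ m c x δ → m * (c * x - δ) ≡ c * (m * x) - δ * m
    distribute = solve-∀ ℚ-ring

  y·columnᵢ≡0 : sumℚ (λ a → y a * M a i) ≡ 0ℚ
  y·columnᵢ≡0 = begin
    sumℚ (λ a → (c * u a - idMat a i) * M a i)                     ≡⟨ sumℚ-cong (λ a → trans (distribute c (u a) (idMat a i) (M a i))
                                                                        (cong (λ m → c * (m * u a) - idMat a i * M a i) (M-sym a i))) ⟩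
    sumℚ (λ a → c * (M i a * u a) - idMat a i * M a i)             ≡⟨ sumℚ-distrib-‿- (λ a → c * (M i a * u a)) (λ a → idMat a i * M a i) ⟩
    sumℚ (λ a → c * (M i a * u a)) - sumℚ (λ a → idMat a i * M a i) ≡⟨ cong₂ _-_ (sumℚ-*ˡ c (λ a → M i a * u a)) (sumℚ-idMat i (λ a → M a i)) ⟩
    c * (M *ᵥ u) i - c                                             ≡⟨ cong (λ v → c * v - c) (trans (Mu≡eᵢ i) (idMat-diag i)) ⟩
    c * 1ℚ - c                                                     ≡⟨ cancel c ⟩
    0ℚ                                                             ∎
    where
    open ≡-Reasoning
    distribute : ∀ c x δ m → (c * x - δ) * m ≡ c * (m * x) - δ * m
    distribute = solve-∀ ℚ-ring
    cancel : ∀ c → c * 1ℚ - c ≡ 0ℚ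
    cancel = solve-∀ ℚ-ring

  quadForm-y : quadForm M y ≡ c * (c * u i - 1ℚ)
  quadForm-y = begin
    sumℚ (λ a → y a * (M *ᵥ y) a)                                  ≡⟨ sumℚ-cong (λ a → cong (y a *_) (*ᵥ-y a)) ⟩
    sumℚ (λ a → y a * (c * idMat a i - M a i))                     ≡⟨ sumℚ-cong (λ a → distribute (y a) c (idMat a i) (M a i)) ⟩
    sumℚ (λ a → c * (idMat a i * y a) - y a * M a i)               ≡⟨ sumℚ-distrib-‿- (λ a → c * (idMat a i * y a)) (λ a → y a * M a i) ⟩
    sumℚ (λ a → c * (idMat a i * y a)) - sumℚ (λ a → y a * M a i)  ≡⟨ cong₂ _-_ (sumℚ-*ˡ c (λ a → idMat a i * y a)) y·columnᵢ≡0 ⟩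
    c * sumℚ (λ a → idMat a i * y a) - 0ℚ                          ≡⟨ +-identityʳ _ ⟩
    c * sumℚ (λ a → idMat a i * y a)                               ≡⟨ cong (c *_) (sumℚ-idMat i y) ⟩
    c * (c * u i - idMat i i)                                      ≡⟨ cong (λ δ → c * (c * u i - δ)) (idMat-diag i) ⟩
    c * (c * u i - 1ℚ)                                             ∎
    where
    open ≡-Reasoning
    distribute : ∀ x c δ m → x * (c * δ - m) ≡ c * (δ * x) - x * m
    distribute = solve-∀ ℚ-ring

psd⇒1≤diag*inverse : ∀ {n} {M : Matrix n} {u : Vector ℚ n} (i : Fin n) →
  SymmetricMatrix M → PositiveSemidefinite M → 0ℚ < M i i →
  (∀ a → (M *ᵥ u) a ≡ idMat a i) → 1ℚ ≤ M i i * u i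
psd⇒1≤diag*inverse {M = M} {u} i M-sym M-psd 0<c Mu≡eᵢ = *-cancelˡ-≤-pos c {{positive 0<c}} (begin
  c * 1ℚ                        ≡⟨ +-identityˡ (c * 1ℚ) ⟨
  0ℚ + c * 1ℚ                   ≤⟨ +-monoˡ-≤ (c * 1ℚ) (M-psd y) ⟩
  quadForm M y + c * 1ℚ         ≡⟨ cong (_+ c * 1ℚ) quadForm-y ⟩
  c * (c * u i - 1ℚ) + c * 1ℚ   ≡⟨ expand c (c * u i) ⟩
  c * (c * u i)                 ∎)
  where
  open InverseColumn i M-sym Mu≡eᵢ
  open ≤-Reasoning
  expand : ∀ c x → c * (x - 1ℚ) + c * 1ℚ ≡ c * x
  expand = solve-∀ ℚ-ring

square-nonNeg : ∀ p → 0ℚ ≤ p * p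
square-nonNeg p with ≤-total 0ℚ p
... | inj₁ 0≤p = nonNegative⁻¹ (p * p) {{nonNeg*nonNeg⇒nonNeg p {{nonNegative 0≤p}} p {{nonNegative 0≤p}}}}
... | inj₂ p≤0 = nonNegative⁻¹ (p * p) {{nonPos*nonPos⇒nonPos p {{nonPositive p≤0}} p {{nonPositive p≤0}}}}

0≤p+p⇒0≤p : ∀ {p} → 0ℚ ≤ p + p → 0ℚ ≤ p
0≤p+p⇒0≤p {p} 0≤p+p = begin
  0ℚ               ≡⟨ *-zeroʳ ½ ⟨
  ½ * 0ℚ           ≤⟨ *-monoˡ-≤-nonNeg ½ 0≤p+p ⟩
  ½ * (p + p)      ≡⟨ halve p ⟩
  p                ∎
  where
  open ≤-Reasoning
  halve : ∀ p → ½ * (p + p) ≡ p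
  halve = solve-∀ ℚ-ring

-- Twice the left-hand side is Σₐ Σ_b A_ab (xₐ - x_b)².
dirichlet-nonNeg : ∀ {n} (A : Matrix n) (x : Vector ℚ n) → SymmetricMatrix A → (∀ a b → 0ℚ ≤ A a b) →
                   0ℚ ≤ sumℚ (λ a → x a * sumℚ (λ b → A a b * (x a - x b)))
dirichlet-nonNeg A x A-sym 0≤A = 0≤p+p⇒0≤p (begin
  0ℚ                                                    ≤⟨ sumℚ-nonNeg _ (λ a → sumℚ-nonNeg _ (λ b →
                                                             nonNegative⁻¹ _ {{nonNeg*nonNeg⇒nonNeg (A a b) {{nonNegative (0≤A a b)}}
                                                               (d a b * d a b) {{nonNegative (square-nonNeg (d a b))}}}})) ⟩
  sumℚ (λ a → sumℚ (λ b → A a b * (d a b * d a b)))     ≡⟨ sumℚ-cong (λ a → sumℚ-cong (λ b → symmetrise a b)) ⟨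
  sumℚ (λ a → sumℚ (λ b → f a b + f b a))               ≡⟨ sumℚ-cong (λ a → sumℚ-distrib-+ (f a) (λ b → f b a)) ⟩
  sumℚ (λ a → sumℚ (f a) + sumℚ (λ b → f b a))          ≡⟨ sumℚ-distrib-+ (λ a → sumℚ (f a)) (λ a → sumℚ (λ b → f b a)) ⟩
  sumℚ (λ a → sumℚ (f a)) + sumℚ (λ a → sumℚ (λ b → f b a))
                                                        ≡⟨ cong (_+_ (sumℚ (λ a → sumℚ (f a)))) (sumℚ-comm f) ⟨
  sumℚ (λ a → sumℚ (f a)) + sumℚ (λ a → sumℚ (f a))     ≡⟨ cong₂ _+_ E≡ΣΣf E≡ΣΣf ⟨
  E + E                                                 ∎)
  where
  open ≤-Reasoning
  d : Fin _ → Fin _ → ℚ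
  d a b = x a - x b
  f : Fin _ → Fin _ → ℚ
  f a b = x a * (A a b * d a b)
  E = sumℚ (λ a → x a * sumℚ (λ b → A a b * d a b))

  E≡ΣΣf : E ≡ sumℚ (λ a → sumℚ (f a))
  E≡ΣΣf = sumℚ-cong (λ a → sym (sumℚ-*ˡ (x a) (λ b → A a b * d a b)))

  identity : ∀ xa xb w → xa * (w * (xa - xb)) + xb * (w * (xb - xa)) ≡ w * ((xa - xb) * (xa - xb))
  identity = solve-∀ ℚ-ring

  symmetrise : ∀ a b → f a b + f b a ≡ A a b * (d a b * d a b)
  symmetrise a b = trans (cong (λ w → f a b + x b * (w * d b a)) (A-sym b a)) (identity (x a) (x b) (A a b))

⊕J-*ᵥ : ∀ {n} (M : Matrix n) (x : Vector ℚ n) a → ((M ⊕ Jmat) *ᵥ x) a ≡ (M *ᵥ x) a + sumℚ x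
⊕J-*ᵥ M x a = trans (sumℚ-cong (λ b → trans (*-distribʳ-+ (x b) (M a b) 1ℚ) (cong (_+_ (M a b * x b)) (*-identityˡ (x b)))))
                      (sumℚ-distrib-+ (λ b → M a b * x b) x)

quadForm-⊕J : ∀ {n} (M : Matrix n) (x : Vector ℚ n) → quadForm (M ⊕ Jmat) x ≡ quadForm M x + sumℚ x * sumℚ x
quadForm-⊕J M x = begin
  sumℚ (λ a → x a * ((M ⊕ Jmat) *ᵥ x) a)                   ≡⟨ sumℚ-cong (λ a → cong (x a *_) (⊕J-*ᵥ M x a)) ⟩
  sumℚ (λ a → x a * ((M *ᵥ x) a + sumℚ x))                 ≡⟨ sumℚ-cong (λ a → distrib (x a) ((M *ᵥ x) a) (sumℚ x)) ⟩
  sumℚ (λ a → x a * (M *ᵥ x) a + sumℚ x * x a)             ≡⟨ sumℚ-distrib-+ (λ a → x a * (M *ᵥ x) a) (λ a → sumℚ x * x a) ⟩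
  quadForm M x + sumℚ (λ a → sumℚ x * x a)                 ≡⟨ cong (_+_ (quadForm M x)) (sumℚ-*ˡ (sumℚ x) x) ⟩
  quadForm M x + sumℚ x * sumℚ x                           ∎
  where
  open ≡-Reasoning
  distrib : ∀ p q s → p * (q + s) ≡ p * q + s * p
  distrib = solve-∀ ℚ-ring

psd-⊕J : ∀ {n} {M : Matrix n} → PositiveSemidefinite M → PositiveSemidefinite (M ⊕ Jmat)
psd-⊕J {M = M} M-psd x = subst (0ℚ ≤_) (sym (quadForm-⊕J M x))
  (subst (_≤ quadForm M x + sumℚ x * sumℚ x) (+-identityʳ 0ℚ) (+-mono-≤ (M-psd x) (square-nonNeg (sumℚ x))))

count : ∀ {n} → Vector Bool n → ℕ
count β = sumℕ (λ j → if β j then 1 else 0)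

count-≤ : ∀ {n} (β : Vector Bool n) → count β ℕ.≤ n
count-≤ {zero}  β = ℕ.z≤n
count-≤ {suc n} β with β zero
... | true  = ℕ.s≤s (count-≤ (β ∘ suc))
... | false = ℕ.m≤n⇒m≤1+n (count-≤ (β ∘ suc))

count-all : ∀ {n} (β : Vector Bool n) → (∀ j → β j ≡ true) → count β ≡ n
count-all {zero}  β all = refl
count-all {suc n} β all rewrite all zero = cong suc (count-all (β ∘ suc) (all ∘ suc))

count-< : ∀ {n} (β : Vector Bool n) {j} → β j ≡ false → count β ℕ.< n
count-< β {zero} βj≡false rewrite βj≡false = ℕ.s≤s (count-≤ (β ∘ suc))
count-< β {suc j} βj≡false with β zero
... | true  = ℕ.s≤s (count-< (β ∘ suc) βj≡false)
... | false = ℕ.m≤n⇒m≤1+n (count-< (β ∘ suc) βj≡false)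

count-removeAt : ∀ {n} (β : Vector Bool (suc n)) {i} → β i ≡ false → count β ≡ count (removeAt β i)
count-removeAt β {zero} βi≡false rewrite βi≡false = refl
count-removeAt {suc n} β {suc i} βi≡false = cong ((if β zero then 1 else 0) ℕ.+_) (count-removeAt (β ∘ suc) βi≡false)

fromℕ-sumℕ : ∀ {n} (f : Fin n → ℕ) → fromℕ (sumℕ f) ≡ sumℚ (fromℕ ∘ f)
fromℕ-sumℕ {zero}  f = refl
fromℕ-sumℕ {suc n} f = trans (fromℕ-+ (f zero) (sumℕ (f ∘ suc))) (cong (_+_ (fromℕ (f zero))) (fromℕ-sumℕ (f ∘ suc)))

module _ {n : ℕ} (G : Graph n) where

  adjMat-sym : SymmetricMatrix (adjMat G)
  adjMat-sym a b = cong (if_then 1ℚ else 0ℚ) (adj-sym G a b)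

  adjMat-nonNeg : ∀ a b → 0ℚ ≤ adjMat G a b
  adjMat-nonNeg a b with adj G a b
  ... | true  = *≤* (ℤ.+≤+ ℕ.z≤n)
  ... | false = ≤-refl

  fromℕ-degree : ∀ a → fromℕ (degree G a) ≡ sumℚ (adjMat G a)
  fromℕ-degree a = trans (fromℕ-sumℕ (λ b → if adj G a b then 1 else 0)) (sumℚ-cong (λ b → fromℕ-indicator (adj G a b)))
    where
    fromℕ-indicator : ∀ β → fromℕ (if β then 1 else 0) ≡ (if β then 1ℚ else 0ℚ)
    fromℕ-indicator true  = refl
    fromℕ-indicator false = refl

  laplacian-diag : ∀ a → laplacian G a a ≡ fromℕ (degree G a)
  laplacian-diag a = trans (cong₂ (λ δ α → (if δ then fromℕ (degree G a) else 0ℚ) + - (if α then 1ℚ else 0ℚ))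
                                  (dec-true (a ≟ a) refl) (irrefl G a))
                           (+-identityʳ (fromℕ (degree G a)))

  laplacian-≢ : ∀ {a b} → a ≢ b → laplacian G a b ≡ - adjMat G a b
  laplacian-≢ {a} {b} a≢b = trans (cong (λ δ → (if δ then fromℕ (degree G a) else 0ℚ) + - adjMat G a b) (dec-false (a ≟ b) a≢b))
                                  (+-identityˡ (- adjMat G a b))

  laplacian-sym : SymmetricMatrix (laplacian G)
  laplacian-sym a b = by-cases (a ≟ b)
    where
    by-cases : Dec (a ≡ b) → laplacian G a b ≡ laplacian G b a
    by-cases (yes refl) = refl
    by-cases (no a≢b)   = trans (laplacian-≢ a≢b) (trans (cong -_ (adjMat-sym a b)) (sym (laplacian-≢ (a≢b ∘ sym))))

  laplacian-*ᵥ : ∀ x a → (laplacian G *ᵥ x) a ≡ sumℚ (λ b → adjMat G a b * (x a - x b))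
  laplacian-*ᵥ x a = begin
    sumℚ (λ b → (degMat G a b + - A a b) * x b)                 ≡⟨ sumℚ-cong (λ b → split (degMat G a b) (A a b) (x b)) ⟩
    sumℚ (λ b → degMat G a b * x b - A a b * x b)               ≡⟨ sumℚ-distrib-‿- (λ b → degMat G a b * x b) (λ b → A a b * x b) ⟩
    sumℚ (λ b → degMat G a b * x b) - sumℚ (λ b → A a b * x b)  ≡⟨ cong (_- sumℚ (λ b → A a b * x b)) (sumℚ-only a (λ b → degMat G a b * x b) off-diagonal) ⟩
    degMat G a a * x a - sumℚ (λ b → A a b * x b)               ≡⟨ cong (λ δ → (if δ then fromℕ (degree G a) else 0ℚ) * x a - sumℚ (λ b → A a b * x b))
                                                                        (dec-true (a ≟ a) refl) ⟩
    fromℕ (degree G a) * x a - sumℚ (λ b → A a b * x b)         ≡⟨ cong (λ d → d * x a - sumℚ (λ b → A a b * x b)) (fromℕ-degree a) ⟩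
    sumℚ (A a) * x a - sumℚ (λ b → A a b * x b)                 ≡⟨ cong (_- sumℚ (λ b → A a b * x b)) (trans (*-comm (sumℚ (A a)) (x a)) (sym (sumℚ-*ˡ (x a) (A a)))) ⟩
    sumℚ (λ b → x a * A a b) - sumℚ (λ b → A a b * x b)         ≡⟨ sumℚ-distrib-‿- (λ b → x a * A a b) (λ b → A a b * x b) ⟨
    sumℚ (λ b → x a * A a b - A a b * x b)                      ≡⟨ sumℚ-cong (λ b → factor (x a) (A a b) (x b)) ⟩
    sumℚ (λ b → A a b * (x a - x b))                            ∎
    where
    open ≡-Reasoning
    A = adjMat G
    split : ∀ δ α y → (δ + - α) * y ≡ δ * y - α * y
    split = solve-∀ ℚ-ring
    factor : ∀ xa α xb → xa * α - α * xb ≡ α * (xa - xb)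
    factor = solve-∀ ℚ-ring
    off-diagonal : ∀ b → b ≢ a → degMat G a b * x b ≡ 0ℚ
    off-diagonal b b≢a = trans (cong (λ δ → (if δ then fromℕ (degree G a) else 0ℚ) * x b) (dec-false (a ≟ b) (b≢a ∘ sym)))
                               (*-zeroˡ (x b))

  laplacian-psd : PositiveSemidefinite (laplacian G)
  laplacian-psd x = subst (0ℚ ≤_) (sumℚ-cong (λ a → cong (x a *_) (sym (laplacian-*ᵥ x a))))
                          (dirichlet-nonNeg (adjMat G) x adjMat-sym adjMat-nonNeg)

  laplacian⊕J-sym : SymmetricMatrix (laplacian G ⊕ Jmat)
  laplacian⊕J-sym a b = cong (_+ 1ℚ) (laplacian-sym a b)

  laplacian⊕J-diag : ∀ a → (laplacian G ⊕ Jmat) a a ≡ fromℕ (suc (degree G a))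
  laplacian⊕J-diag a = trans (cong (_+ 1ℚ) (laplacian-diag a)) (trans (+-comm (fromℕ (degree G a)) 1ℚ) (sym (fromℕ-+ 1 (degree G a))))

  dominating⇒laplacian⊕J-column : ∀ {i} → Dominating G i → ∀ a → a ≢ i → (laplacian G ⊕ Jmat) a i ≡ 0ℚ
  dominating⇒laplacian⊕J-column {i} dom a a≢i =
    cong (_+ 1ℚ) (trans (laplacian-≢ a≢i) (cong (λ β → - (if β then 1ℚ else 0ℚ)) (trans (adj-sym G a i) (dom a a≢i))))

module _ {m : ℕ} (G : Graph (suc m)) where

  degree-≤ : ∀ i → degree G i ℕ.≤ m
  degree-≤ i = subst (ℕ._≤ m) (sym (count-removeAt (adj G i) (irrefl G i))) (count-≤ (removeAt (adj G i) i))

  dominating⇒degree≡ : ∀ {i} → Dominating G i → degree G i ≡ m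
  dominating⇒degree≡ {i} dom = trans (count-removeAt (adj G i) (irrefl G i))
    (count-all (removeAt (adj G i) i) (λ k → dom (punchIn i k) (punchInᵢ≢i i k)))

  nonadjacent⇒degree< : ∀ {i j} → j ≢ i → adj G i j ≡ false → degree G i ℕ.< m
  nonadjacent⇒degree< {i} {j} j≢i ij∉E = subst (ℕ._< m) (sym (count-removeAt (adj G i) (irrefl G i)))
    (count-< (removeAt (adj G i) i) (trans (cong (adj G i) (punchIn-punchOut (j≢i ∘ sym))) ij∉E))

module DiagonalOfInverse {m : ℕ} (G : Graph (suc m)) (K : Matrix (suc m))
                         (K⁻¹ : IsInverseOf K (laplacian G ⊕ Jmat)) (i : Fin (suc m)) where

  1/[dᵢ+1]≤Kᵢᵢ : + 1 / suc (degree G i) ≤ K i i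
  1/[dᵢ+1]≤Kᵢᵢ = 1≤[1+n]p⇒1/[1+n]≤p (degree G i) (subst (λ c → 1ℚ ≤ c * K i i) (laplacian⊕J-diag G i)
    (psd⇒1≤diag*inverse {u = λ a → K a i} i (laplacian⊕J-sym G) (psd-⊕J {M = laplacian G} (laplacian-psd G)) 0<Mᵢᵢ (λ a → proj₁ K⁻¹ a i)))
    where
    0<Mᵢᵢ : 0ℚ < (laplacian G ⊕ Jmat) i i
    0<Mᵢᵢ = subst (0ℚ <_) (sym (laplacian⊕J-diag G i))
                  (positive⁻¹ (fromℕ (suc (degree G i))) {{normalize-pos (suc (degree G i)) 1}})

  dominating⇒Kᵢᵢ≡ : Dominating G i → K i i ≡ + 1 / suc m
  dominating⇒Kᵢᵢ≡ dom = trans (p[1+n]≡1⇒p≡1/[1+n] (degree G i) Kᵢᵢ[dᵢ+1]≡1) (cong (λ d → + 1 / suc d) (dominating⇒degree≡ G dom))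
    where
    open ≡-Reasoning
    Kᵢᵢ[dᵢ+1]≡1 : K i i * fromℕ (suc (degree G i)) ≡ 1ℚ
    Kᵢᵢ[dᵢ+1]≡1 = begin
      K i i * fromℕ (suc (degree G i))      ≡⟨ cong (K i i *_) (laplacian⊕J-diag G i) ⟨
      K i i * (laplacian G ⊕ Jmat) i i      ≡⟨ sumℚ-only i (λ a → K i a * (laplacian G ⊕ Jmat) a i) (λ a a≢i →
                                                 trans (cong (K i a *_) (dominating⇒laplacian⊕J-column G dom a a≢i)) (*-zeroʳ (K i a))) ⟨
      (K ⊗ (laplacian G ⊕ Jmat)) i i        ≡⟨ proj₂ K⁻¹ i i ⟩
      idMat i i                             ≡⟨ idMat-diag i ⟩
      1ℚ                                    ∎

  Kᵢᵢ≡⇒dominating : K i i ≡ + 1 / suc m → Dominating G i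
  Kᵢᵢ≡⇒dominating Kᵢᵢ≡ j j≢i with adj G i j in ij
  ... | true  = refl
  ... | false = ⊥-elim (<-irrefl refl (<-≤-trans (1/suc-antimono-< (nonadjacent⇒degree< G j≢i ij))
                                                 (subst (_ ≤_) Kᵢᵢ≡ 1/[dᵢ+1]≤Kᵢᵢ)))

lemma6p3 : (m : ℕ) (G : Graph (suc m)) → Connected G →
    (K : Matrix (suc m)) → IsInverseOf K (laplacian G ⊕ Jmat) →
    (i : Fin (suc m)) →
      ((+ 1 / suc (degree G i)) ≤ K i i)
      × ((+ 1 / suc m) ≤ K i i)
      × ((K i i ≡ (+ 1 / suc m)) ⇔ Dominating G i)
lemma6p3 m G _ K K⁻¹ i =
  1/[dᵢ+1]≤Kᵢᵢ , ≤-trans (1/suc-antimono-≤ (degree-≤ G i)) 1/[dᵢ+1]≤Kᵢᵢ , mk⇔ Kᵢᵢ≡⇒dominating dominating⇒Kᵢᵢ≡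
  where open DiagonalOfInverse G K K⁻¹ i
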